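{- Let $\mathbf P=(P,+,\bar{}\,,\tilde{}\,,0,1)$ be a good monotonous pseudoeffect algebra with induced order $\leq$ and define, for $x,y\in P$, $x\odot y:=\widetilde{\bar x+\bar y}$, defined if and only if $\tilde x\leq y$; $x\rightarrow y:=\bar x+L(x,y)=\{\bar x+u\mid u\in L(x,y)\}$; $x\leadsto y:=L(x,y)+\tilde x=\{u+\tilde x\mid u\in L(x,y)\}$. Then $(P,\leq,\odot,\rightarrow,\leadsto,\bar{}\,,\tilde{}\,,0,1)$ is a divisible unsharp residuated poset.
   Context: A pseudoeffect algebra is a partial algebra $(P,+,\bar{}\,,\tilde{}\,,0,1)$ of type $(2,1,1,0,0)$ where $(P,\bar{}\,,\tilde{}\,,0,1)$ is an algebra and $+$ is a partial binary operation such that for all $x,y,z\in P$: (P1) if $x+y$ is defined then there exist $u,w\in P$ with $u+x=y+w=x+y$; (P2) $(x+y)+z$ is defined iff $x+(y+z)$ is defined, and then they are equal; (P3) $\bar x$ is the unique $u$ with $u+x=1$ and $\tilde x$ is the unique $w$ with $x+w=1$; (P4) if $1+x$ or $x+1$ is defined then $x=0$. The induced order is $x\leq y$ iff there is $z$ with $x+z=y$; it makes $P$ a bounded poset. We write $\widetilde{t}$ and $\overline{t}$ for the unary operations applied to a term $t$. For a poset and $A\subseteq P$: $L(A)=\{x\mid x\leq y\ \forall y\in A\}$, $U(A)=\{x\mid y\leq x\ \forall y\in A\}$; $L(a,b)=L(\{a,b\})$, $U(a,b)=U(\{a,b\})$, $LU(A)=L(U(A))$, $UL(a,b)=U(L(\{a,b\}))$.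 For subsets $A,B$, $A\leq B$ means $x\leq y$ for all $x\in A,y\in B$ (similarly with single elements). Operations are extended elementwise to subsets, e.g. $x+A=\{x+y\mid y\in A\}$, $A+x=\{y+x\mid y\in A\}$, $A\odot y=\{u\odot y\mid u\in A\}$, $y\odot A=\{y\odot u\mid u\in A\}$. $\mathbf P$ is good if $\widetilde{\bar x+\bar y}=\overline{\tilde x+\tilde y}$ for all $x,y\in P$ with $\tilde x\leq y$. $\mathbf P$ is monotonous if for all $x\in P$ and non-empty $A,B\subseteq P$: $A\cup B\leq\bar x$ and $L(A)\leq U(B)$ imply $L(A+x)\leq U(B+x)$; and $A\cup B\leq\tilde x$ and $L(A)\leq U(B)$ imply $L(x+A)\leq U(x+B)$. A partial monoid $(R,\odot,1)$ is a set with a partial binary operation such that $(x\odot y)\odot z$ is defined iff $x\odot(y\odot z)$ is defined and then they are equal, and $x\odot1=1\odot x=x$. An unsharp residuated poset is a tuple $(R,\leq,\odot,\rightarrow,\leadsto,\bar{}\,,\tilde{}\,,0,1)$ with $\rightarrow,\leadsto:R^2\to 2^R$ and unary operations $\bar{}\,,\tilde{}$ such that for all $x,y,z\in R$: (R1) $(R,\leq,0,1)$ is a bounded poset; (R2) $\tilde{\bar x}=\bar{\tilde x}=x$, and $x\leq y$ implies $\bar y\leq\bar x$ and $\tilde y\leq\tilde x$; (R3) $(R,\odot,1)$ is a partial monoid where $x\odot y$ is defined iff $\tilde x\leq y$, and $\bar z\leq x\leq y$ implies $x\odot z\leq y\odot z$, and $\tilde z\leq x\leq y$ implies $z\odot x\leq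 z\odot y$; (R4) $L(U(x,\bar y)\odot y)\leq UL(y,z)$ iff $LU(x,\bar y)\leq U(y\rightarrow z)$; (R5) $L(y\odot U(x,\tilde y))\leq UL(y,z)$ iff $LU(x,\tilde y)\leq U(y\leadsto z)$; (R6) $x\rightarrow0=\{\bar x\}$ and $x\leadsto 0=\{\tilde x\}$; (R7) $\widetilde{\bar x\odot\bar y}=\overline{\tilde x\odot\tilde y}$. It is divisible if $x\leq y$ implies $(y\rightarrow x)\odot y=y\odot(y\leadsto x)=L(x)$. -}

module Defs where

open import Level using (0ℓ)
open import Data.Maybe using (Maybe; just; nothing; map; _>>=_)
open import Data.Product using (Σ; ∃; _×_; _,_)
open import Data.Sum using (_⊎_)
open import Relation.Binary.PropositionalEquality using (_≡_)
open import Relation.Binary.Structures using (IsPartialOrder)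
open import Function.Bundles using (_⇔_)

Subset : Set → Set₁
Subset R = R → Set

pair : {R : Set} → R → R → Subset R
pair a b z = (z ≡ a) ⊎ (z ≡ b)

single : {R : Set} → R → Subset R
single a z = z ≡ a

NonEmpty : {R : Set} → Subset R → Set
NonEmpty A = ∃ λ a → A a

module OrderOps {R : Set} (_≤_ : R → R → Set) where

  L : Subset R → Subset R
  L A x = ∀ y → A y → x ≤ y

  U : Subset R → Subset R
  U A x = ∀ y → A y → y ≤ x

  _≤ˢ_ : Subset R → Subset R → Set
  A ≤ˢ B = ∀ x y → A x → B y → x ≤ y

-- Partial binary operations given by their graph:  x ⊙ y ≔ z
-- means "x ⊙ y is defined and equals z".

PartialOp : Set → Set₁
PartialOp R = R → R → R → Set

imgˡ : {R : Set} → PartialOp R → Subset R → R → Subset R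
imgˡ op A y w = ∃ λ u → A u × op u y w

imgʳ : {R : Set} → PartialOp R → R → Subset R → Subset R
imgʳ op y A w = ∃ λ u → A u × op y u w

record PseudoEffectAlgebra : Set₁ where
  field
    Carrier : Set
    _⊕_     : Carrier → Carrier → Maybe Carrier
    bar     : Carrier → Carrier
    tilde   : Carrier → Carrier
    𝟎       : Carrier
    𝟏       : Carrier
    P1 : ∀ x y z → x ⊕ y ≡ just z →
         ∃ λ u → ∃ λ w → (u ⊕ x ≡ just z) × (y ⊕ w ≡ just z)
    -- (P2): (x+y)+z defined iff x+(y+z) defined, and then equal
    P2 : ∀ x y z → ((x ⊕ y) >>= λ v → v ⊕ z) ≡ ((y ⊕ z) >>= λ v → x ⊕ v)
    P3-bar         : ∀ x → bar x ⊕ x ≡ just 𝟏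
    P3-bar-unique  : ∀ x u → u ⊕ x ≡ just 𝟏 → u ≡ bar x
    P3-tilde       : ∀ x → x ⊕ tilde x ≡ just 𝟏
    P3-tilde-unique : ∀ x w → x ⊕ w ≡ just 𝟏 → w ≡ tilde x
    P4 : ∀ x → ((∃ λ z → 𝟏 ⊕ x ≡ just z) ⊎ (∃ λ z → x ⊕ 𝟏 ≡ just z)) → x ≡ 𝟎

module PEA (𝐏 : PseudoEffectAlgebra) where
  open PseudoEffectAlgebra 𝐏 public

  _≤_ : Carrier → Carrier → Set
  x ≤ y = ∃ λ z → x ⊕ z ≡ just y

  open OrderOps _≤_ public

  _+ˢ_ : Subset Carrier → Carrier → Subset Carrier
  (A +ˢ x) w = ∃ λ y → A y × (y ⊕ x ≡ just w)

  _ˢ+_ : Carrier → Subset Carrier → Subset Carrier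
  (x ˢ+ A) w = ∃ λ y → A y × (x ⊕ y ≡ just w)

  IsGood : Set
  IsGood = ∀ x y → tilde x ≤ y →
           map tilde (bar x ⊕ bar y) ≡ map bar (tilde x ⊕ tilde y)

  IsMonotonous : Set₁
  IsMonotonous =
    (∀ x (A B : Subset Carrier) → NonEmpty A → NonEmpty B →
       (∀ a → (A a ⊎ B a) → a ≤ bar x) → L A ≤ˢ U B →
       L (A +ˢ x) ≤ˢ U (B +ˢ x))
    ×
    (∀ x (A B : Subset Carrier) → NonEmpty A → NonEmpty B →
       (∀ a → (A a ⊎ B a) → a ≤ tilde x) → L A ≤ˢ U B →
       L (x ˢ+ A) ≤ˢ U (x ˢ+ B))

  _⊙_≔_ : PartialOp Carrier
  x ⊙ y ≔ z = (tilde x ≤ y) × (map tilde (bar x ⊕ bar y) ≡ just z)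

  _⇒_ : Carrier → Carrier → Subset Carrier
  x ⇒ y = bar x ˢ+ L (pair x y)

  _⇝_ : Carrier → Carrier → Subset Carrier
  x ⇝ y = L (pair x y) +ˢ tilde x

record IsUnsharpResiduatedPoset
  (R : Set) (_≤_ : R → R → Set) (_⊙_≔_ : PartialOp R)
  (_⇒_ _⇝_ : R → R → Subset R) (bar tilde : R → R) (𝟎 𝟏 : R) : Set₁ where
  open OrderOps _≤_
  field
    R1-partialOrder : IsPartialOrder _≡_ _≤_
    R1-bottom : ∀ x → 𝟎 ≤ x
    R1-top    : ∀ x → x ≤ 𝟏
    R2-tilde-bar : ∀ x → tilde (bar x) ≡ x
    R2-bar-tilde : ∀ x → bar (tilde x) ≡ x
    R2-bar-anti   : ∀ x y → x ≤ y → bar y ≤ bar x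
    R2-tilde-anti : ∀ x y → x ≤ y → tilde y ≤ tilde x
    R3-functional : ∀ x y z z′ → x ⊙ y ≔ z → x ⊙ y ≔ z′ → z ≡ z′
    R3-assoc : ∀ x y z w →
      (∃ λ v → (x ⊙ y ≔ v) × (v ⊙ z ≔ w)) ⇔ (∃ λ v → (y ⊙ z ≔ v) × (x ⊙ v ≔ w))
    R3-unitʳ : ∀ x → x ⊙ 𝟏 ≔ x
    R3-unitˡ : ∀ x → 𝟏 ⊙ x ≔ x
    R3-domain : ∀ x y → (∃ λ z → x ⊙ y ≔ z) ⇔ (tilde x ≤ y)
    R3-monoˡ : ∀ x y z a b → bar z ≤ x → x ≤ y →
               x ⊙ z ≔ a → y ⊙ z ≔ b → a ≤ b
    R3-monoʳ : ∀ x y z a b → tilde z ≤ x → x ≤ y →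
               z ⊙ x ≔ a → z ⊙ y ≔ b → a ≤ b
    R4 : ∀ x y z →
      (L (imgˡ _⊙_≔_ (U (pair x (bar y))) y) ≤ˢ U (L (pair y z)))
      ⇔ (L (U (pair x (bar y))) ≤ˢ U (y ⇒ z))
    R5 : ∀ x y z →
      (L (imgʳ _⊙_≔_ y (U (pair x (tilde y)))) ≤ˢ U (L (pair y z)))
      ⇔ (L (U (pair x (tilde y))) ≤ˢ U (y ⇝ z))
    R6-⇒ : ∀ x w → (x ⇒ 𝟎) w ⇔ (w ≡ bar x)
    R6-⇝ : ∀ x w → (x ⇝ 𝟎) w ⇔ (w ≡ tilde x)
    -- (R7): both sides defined simultaneously, and then equal
    R7 : ∀ x y w →
      (∃ λ a → (bar x ⊙ bar y ≔ a) × (tilde a ≡ w))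
      ⇔ (∃ λ b → (tilde x ⊙ tilde y ≔ b) × (bar b ≡ w))

IsDivisible : (R : Set) (_≤_ : R → R → Set) (_⊙_≔_ : PartialOp R)
  (_⇒_ _⇝_ : R → R → Subset R) → Set
IsDivisible R _≤_ _⊙_≔_ _⇒_ _⇝_ =
  ∀ x y → x ≤ y →
    (∀ w → imgˡ _⊙_≔_ (y ⇒ x) y w ⇔ L (single x) w)
    × (∀ w → imgʳ _⊙_≔_ y (y ⇝ x) w ⇔ L (single x) w)
  where open OrderOps _≤_

module Submission where

-- The product is + conjugated by the complements: x ⊙ y ≔ z iff x̄ + ȳ = z̄, equivalently
-- ȳ + z = x, equivalently (for y ⊙ x ≔ z) z + ỹ = x; in a good algebra also x̃ + ỹ = z̃.
-- So the monoid, monotonicity, divisibility and (R7) axioms are transported from +.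
-- For (R4) (and dually (R5)) let A = U(x,ȳ): since ȳ + (A ⊙ y) = A, monotonicity of
-- adding ȳ turns the left condition into the right one. Conversely the complements are
-- order anti-isomorphisms exchanging L and U, so the right condition is a statement about
-- complemented sets, to which monotonicity applies again; complementing back gives the left.

open import Defs
open import Data.Maybe using (Maybe; just; map; _>>=_)
open import Data.Maybe.Properties using (just-injective; map-injective)
open import Data.Product using (_×_; ∃; _,_; proj₁; proj₂)
open import Data.Sum using (_⊎_; inj₁; inj₂)
open import Function using (_∘_)
open import Function.Bundles using (_⇔_; mk⇔; Equivalence)
open import Function.Properties.Equivalence using () renaming (trans to ⇔-trans)
open import Relation.Binary.PropositionalEquality
  using (_≡_; refl; sym; trans; cong; subst; subst₂; isEquivalence)
open import Relation.Binary.Structures using (IsPartialOrder)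
open import Relation.Unary using (_⊆_)

>>=-just : {A B : Set} (m : Maybe A) {f : A → Maybe B} {e : B} →
           (m >>= f) ≡ just e → ∃ λ c → (m ≡ just c) × (f c ≡ just e)
>>=-just (just c) eq = c , refl , eq

module PseudoEffectAlgebraProperties (𝐏 : PseudoEffectAlgebra) where
  open PEA 𝐏
  open Equivalence using (to; from)

  ⊕-functional : ∀ {a b c c′} → a ⊕ b ≡ just c → a ⊕ b ≡ just c′ → c ≡ c′
  ⊕-functional p q = just-injective (trans (sym p) q)

  ⊕-assocʳ : ∀ {a b c d e} → a ⊕ b ≡ just c → c ⊕ d ≡ just e →
             ∃ λ f → (b ⊕ d ≡ just f) × (a ⊕ f ≡ just e)
  ⊕-assocʳ {a} {b} {d = d} ab cd =
    >>=-just (b ⊕ d) (trans (sym (P2 a b d)) (trans (cong (λ m → m >>= λ v → v ⊕ d) ab) cd))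

  ⊕-assocˡ : ∀ {a b d f e} → b ⊕ d ≡ just f → a ⊕ f ≡ just e →
             ∃ λ c → (a ⊕ b ≡ just c) × (c ⊕ d ≡ just e)
  ⊕-assocˡ {a} {b} {d} bd af =
    >>=-just (a ⊕ b) (trans (P2 a b d) (trans (cong (λ m → m >>= λ v → a ⊕ v) bd) af))

  tilde∘bar : ∀ x → tilde (bar x) ≡ x
  tilde∘bar x = sym (P3-tilde-unique (bar x) x (P3-bar x))

  bar∘tilde : ∀ x → bar (tilde x) ≡ x
  bar∘tilde x = sym (P3-bar-unique (tilde x) x (P3-tilde x))

  bar-injective : ∀ {x y} → bar x ≡ bar y → x ≡ y
  bar-injective {x} {y} eq = subst₂ _≡_ (tilde∘bar x) (tilde∘bar y) (cong tilde eq)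

  tilde-injective : ∀ {x y} → tilde x ≡ tilde y → x ≡ y
  tilde-injective {x} {y} eq = subst₂ _≡_ (bar∘tilde x) (bar∘tilde y) (cong bar eq)

  bar-𝟏 : bar 𝟏 ≡ 𝟎
  bar-𝟏 = P4 (bar 𝟏) (inj₂ (𝟏 , P3-bar 𝟏))

  tilde-𝟏 : tilde 𝟏 ≡ 𝟎
  tilde-𝟏 = P4 (tilde 𝟏) (inj₁ (𝟏 , P3-tilde 𝟏))

  -- Regrouping (a + b) + ~c = 1, resp. c̄ + (a + b) = 1, and using uniqueness in (P3).
  ⊕-tilde : ∀ {a b c} → a ⊕ b ≡ just c → b ⊕ tilde c ≡ just (tilde a)
  ⊕-tilde {a} {b} {c} ab with ⊕-assocʳ ab (P3-tilde c)
  ... | f , b⊕c̃ , a⊕f = subst (λ t → b ⊕ tilde c ≡ just t) (P3-tilde-unique a f a⊕f) b⊕c̃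

  ⊕-bar : ∀ {a b c} → a ⊕ b ≡ just c → bar c ⊕ a ≡ just (bar b)
  ⊕-bar {a} {b} {c} ab with ⊕-assocˡ ab (P3-bar c)
  ... | g , c̄⊕a , g⊕b = subst (λ t → bar c ⊕ a ≡ just t) (P3-bar-unique b g g⊕b) c̄⊕a

  ⊕-cancelˡ : ∀ {a b b′ c} → a ⊕ b ≡ just c → a ⊕ b′ ≡ just c → b ≡ b′
  ⊕-cancelˡ ab ab′ = bar-injective (just-injective (trans (sym (⊕-bar ab)) (⊕-bar ab′)))

  ⊕-cancelʳ : ∀ {a a′ b c} → a ⊕ b ≡ just c → a′ ⊕ b ≡ just c → a ≡ a′
  ⊕-cancelʳ ab a′b = tilde-injective (just-injective (trans (sym (⊕-tilde ab)) (⊕-tilde a′b)))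

  ⊕-identityʳ : ∀ x → x ⊕ 𝟎 ≡ just x
  ⊕-identityʳ x = subst₂ (λ s t → x ⊕ s ≡ just t) tilde-𝟏 (tilde∘bar x) (⊕-tilde (P3-bar x))

  ⊕-identityˡ : ∀ x → 𝟎 ⊕ x ≡ just x
  ⊕-identityˡ x = subst₂ (λ s t → s ⊕ x ≡ just t) bar-𝟏 (bar∘tilde x) (⊕-bar (P3-tilde x))

  ⊕-zeroˡ : ∀ {a b} → a ⊕ b ≡ just 𝟎 → a ≡ 𝟎
  ⊕-zeroˡ {a} ab with ⊕-assocˡ ab (⊕-identityʳ 𝟏)
  ... | c , 𝟏⊕a , _ = P4 a (inj₁ (c , 𝟏⊕a))

  ⊕⇒≤ʳ : ∀ {u x y} → u ⊕ x ≡ just y → x ≤ y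
  ⊕⇒≤ʳ {u} {x} {y} eq with P1 u x y eq
  ... | _ , w , _ , x⊕w = w , x⊕w

  ≤-refl : ∀ x → x ≤ x
  ≤-refl x = 𝟎 , ⊕-identityʳ x

  ≤-trans : ∀ {x y z} → x ≤ y → y ≤ z → x ≤ z
  ≤-trans (a , x⊕a) (b , y⊕b) with ⊕-assocʳ x⊕a y⊕b
  ... | f , _ , x⊕f = f , x⊕f

  ≤-antisym : ∀ {x y} → x ≤ y → y ≤ x → x ≡ y
  ≤-antisym {x} (a , x⊕a) (b , y⊕b) with ⊕-assocʳ x⊕a y⊕b
  ... | f , a⊕b , x⊕f with ⊕-cancelˡ x⊕f (⊕-identityʳ x)
  ... | refl with ⊕-zeroˡ a⊕b
  ... | refl = ⊕-functional (⊕-identityʳ x) x⊕a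

  ≤-isPartialOrder : IsPartialOrder _≡_ _≤_
  ≤-isPartialOrder = record
    { isPreorder = record
        { isEquivalence = isEquivalence
        ; reflexive = λ { {x} refl → ≤-refl x }
        ; trans = ≤-trans
        }
    ; antisym = ≤-antisym
    }

  𝟎-least : ∀ x → 𝟎 ≤ x
  𝟎-least x = x , ⊕-identityˡ x

  𝟏-greatest : ∀ x → x ≤ 𝟏
  𝟏-greatest x = tilde x , P3-tilde x

  𝟎∈L : ∀ {A} → L A 𝟎
  𝟎∈L y _ = 𝟎-least y

  𝟏∈U : ∀ {A} → U A 𝟏
  𝟏∈U y _ = 𝟏-greatest y

  L-pair-𝟎 : ∀ {x u} → L (pair x 𝟎) u → u ≡ 𝟎
  L-pair-𝟎 {u = u} h = ≤-antisym (h 𝟎 (inj₂ refl)) (𝟎-least u)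

  bar-antitone : ∀ {x y} → x ≤ y → bar y ≤ bar x
  bar-antitone {x} {y} (a , x⊕a) with P1 x a y x⊕a
  ... | u , _ , u⊕x , _ = u , ⊕-bar u⊕x

  tilde-antitone : ∀ {x y} → x ≤ y → tilde y ≤ tilde x
  tilde-antitone (a , x⊕a) = ⊕⇒≤ʳ (⊕-tilde x⊕a)

  ≤tilde⇒≤bar : ∀ {x p} → x ≤ tilde p → p ≤ bar x
  ≤tilde⇒≤bar {p = p} h = subst (_≤ _) (bar∘tilde p) (bar-antitone h)

  ≤bar⇒≤tilde : ∀ {x p} → x ≤ bar p → p ≤ tilde x
  ≤bar⇒≤tilde {p = p} h = subst (_≤ _) (tilde∘bar p) (tilde-antitone h)

  bar-reflects-≤ : ∀ {x y} → bar y ≤ bar x → x ≤ y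
  bar-reflects-≤ {y = y} h = subst (_ ≤_) (tilde∘bar y) (≤bar⇒≤tilde h)

  ⊕-defined⇒≤tilde : ∀ {a b c} → a ⊕ b ≡ just c → b ≤ tilde a
  ⊕-defined⇒≤tilde ab = _ , ⊕-tilde ab

  ⊕-defined⇒≤bar : ∀ {a b c} → a ⊕ b ≡ just c → a ≤ bar b
  ⊕-defined⇒≤bar ab = ⊕⇒≤ʳ (⊕-bar ab)

  ≤tilde⇒⊕-defined : ∀ {a b} → b ≤ tilde a → ∃ λ c → a ⊕ b ≡ just c
  ≤tilde⇒⊕-defined {a} (d , b⊕d) with ⊕-assocˡ b⊕d (P3-tilde a)
  ... | c , a⊕b , _ = c , a⊕b

  ⊕-monoˡ-≤ : ∀ {a a′ b s s′} → a ≤ a′ → a ⊕ b ≡ just s → a′ ⊕ b ≡ just s′ → s ≤ s′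
  ⊕-monoˡ-≤ {a} {a′} (d , a⊕d) ab a′b with P1 a d a′ a⊕d
  ... | u , _ , u⊕a , _ with ⊕-assocʳ u⊕a a′b
  ... | f , ab′ , u⊕f = ⊕⇒≤ʳ (subst (λ t → _ ⊕ t ≡ _) (⊕-functional ab′ ab) u⊕f)

  ⊕-monoʳ-≤ : ∀ {a b b′ s s′} → b ≤ b′ → a ⊕ b ≡ just s → a ⊕ b′ ≡ just s′ → s ≤ s′
  ⊕-monoʳ-≤ (d , b⊕d) ab ab′ with ⊕-assocˡ b⊕d ab′
  ... | c , ab″ , c⊕d = d , subst (λ t → t ⊕ d ≡ _) (⊕-functional ab″ ab) c⊕d

  ⊙-elim : ∀ {x y z} → x ⊙ y ≔ z → bar x ⊕ bar y ≡ just (bar z)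
  ⊙-elim {z = z} (_ , e) = map-injective tilde-injective (trans e (cong just (sym (tilde∘bar z))))

  ⊙-intro : ∀ {x y z} → bar x ⊕ bar y ≡ just (bar z) → x ⊙ y ≔ z
  ⊙-intro {x} {y} {z} e =
    subst (tilde x ≤_) (tilde∘bar y) (tilde-antitone (subst (_ ≤_) (tilde∘bar x) (⊕-defined⇒≤tilde e))) ,
    trans (cong (map tilde) e) (cong just (tilde∘bar z))

  ⊙-functional : ∀ {x y z z′} → x ⊙ y ≔ z → x ⊙ y ≔ z′ → z ≡ z′
  ⊙-functional (_ , e) (_ , e′) = just-injective (trans (sym e) e′)

  ⊙-domain : ∀ x y → (∃ λ z → x ⊙ y ≔ z) ⇔ (tilde x ≤ y)
  ⊙-domain x y = mk⇔ (λ { (_ , h , _) → h }) defined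
    where
    defined : tilde x ≤ y → ∃ λ z → x ⊙ y ≔ z
    defined h with ≤tilde⇒⊕-defined {bar x} {bar y} (subst (_ ≤_) (trans (bar∘tilde x) (sym (tilde∘bar x))) (bar-antitone h))
    ... | t , e = tilde t , ⊙-intro (subst (λ s → _ ≡ just s) (sym (bar∘tilde t)) e)

  ⊙-identityˡ : ∀ x → 𝟏 ⊙ x ≔ x
  ⊙-identityˡ x = ⊙-intro (subst (λ s → s ⊕ bar x ≡ just (bar x)) (sym bar-𝟏) (⊕-identityˡ (bar x)))

  ⊙-identityʳ : ∀ x → x ⊙ 𝟏 ≔ x
  ⊙-identityʳ x = ⊙-intro (subst (λ s → bar x ⊕ s ≡ just (bar x)) (sym bar-𝟏) (⊕-identityʳ (bar x)))

  ⊙-assoc : ∀ x y z w →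
    (∃ λ v → (x ⊙ y ≔ v) × (v ⊙ z ≔ w)) ⇔ (∃ λ v → (y ⊙ z ≔ v) × (x ⊙ v ≔ w))
  ⊙-assoc x y z w = mk⇔ right left
    where
    right : (∃ λ v → (x ⊙ y ≔ v) × (v ⊙ z ≔ w)) → ∃ λ v → (y ⊙ z ≔ v) × (x ⊙ v ≔ w)
    right (_ , xy , vz) with ⊕-assocʳ (⊙-elim xy) (⊙-elim vz)
    ... | f , yz , xf = tilde f , ⊙-intro (subst (λ s → _ ≡ just s) (sym (bar∘tilde f)) yz)
                                , ⊙-intro (subst (λ s → _ ⊕ s ≡ _) (sym (bar∘tilde f)) xf)
    left : (∃ λ v → (y ⊙ z ≔ v) × (x ⊙ v ≔ w)) → ∃ λ v → (x ⊙ y ≔ v) × (v ⊙ z ≔ w)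
    left (_ , yz , xv) with ⊕-assocˡ (⊙-elim yz) (⊙-elim xv)
    ... | c , xy , cz = tilde c , ⊙-intro (subst (λ s → _ ≡ just s) (sym (bar∘tilde c)) xy)
                                , ⊙-intro (subst (λ s → s ⊕ _ ≡ _) (sym (bar∘tilde c)) cz)

  ⊙-monoˡ-≤ : ∀ {x y z a b} → x ≤ y → x ⊙ z ≔ a → y ⊙ z ≔ b → a ≤ b
  ⊙-monoˡ-≤ x≤y xz yz = bar-reflects-≤ (⊕-monoˡ-≤ (bar-antitone x≤y) (⊙-elim yz) (⊙-elim xz))

  ⊙-monoʳ-≤ : ∀ {x y z a b} → x ≤ y → z ⊙ x ≔ a → z ⊙ y ≔ b → a ≤ b
  ⊙-monoʳ-≤ x≤y zx zy = bar-reflects-≤ (⊕-monoʳ-≤ (bar-antitone x≤y) (⊙-elim zy) (⊙-elim zx))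

  ⊙≔⇔bar-⊕ : ∀ {u y v} → u ⊙ y ≔ v ⇔ bar y ⊕ v ≡ just u
  ⊙≔⇔bar-⊕ {u} {y} {v} = mk⇔
    (λ uy → subst₂ (λ s t → bar y ⊕ s ≡ just t) (tilde∘bar v) (tilde∘bar u) (⊕-tilde (⊙-elim uy)))
    (λ yv → ⊙-intro (⊕-bar yv))

  ⊙≔⇔⊕-tilde : ∀ {y u v} → y ⊙ u ≔ v ⇔ v ⊕ tilde y ≡ just u
  ⊙≔⇔⊕-tilde {y} {u} {v} = mk⇔
    (λ yu → subst (λ t → v ⊕ tilde y ≡ just t) (tilde∘bar u)
              (⊕-tilde (subst₂ (λ s t → bar u ⊕ s ≡ just t) (tilde∘bar v) (tilde∘bar y) (⊕-tilde (⊙-elim yu)))))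
    (λ vy → ⊙-intro (⊕-bar (subst (λ t → bar u ⊕ v ≡ just t) (bar∘tilde y) (⊕-bar vy))))

  ⇒-𝟎 : ∀ x w → (x ⇒ 𝟎) w ⇔ (w ≡ bar x)
  ⇒-𝟎 x w = mk⇔
    (λ { (u , hu , e) → ⊕-functional e (subst (λ t → bar x ⊕ t ≡ _) (sym (L-pair-𝟎 hu)) (⊕-identityʳ (bar x))) })
    (λ { refl → 𝟎 , 𝟎∈L , ⊕-identityʳ (bar x) })

  ⇝-𝟎 : ∀ x w → (x ⇝ 𝟎) w ⇔ (w ≡ tilde x)
  ⇝-𝟎 x w = mk⇔
    (λ { (u , hu , e) → ⊕-functional e (subst (λ t → t ⊕ tilde x ≡ _) (sym (L-pair-𝟎 hu)) (⊕-identityˡ (tilde x))) })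
    (λ { refl → 𝟎 , 𝟎∈L , ⊕-identityˡ (tilde x) })

  isDivisible : IsDivisible Carrier _≤_ _⊙_≔_ _⇒_ _⇝_
  isDivisible x y x≤y = (λ w → mk⇔ ⇒-below ⇒-attained) , (λ w → mk⇔ ⇝-below ⇝-attained)
    where
    L-single⇒L-pair : ∀ {w} → L (single x) w → L (pair y x) w
    L-single⇒L-pair hw _ (inj₁ refl) = ≤-trans (hw x refl) x≤y
    L-single⇒L-pair hw _ (inj₂ refl) = hw x refl

    L-pair⇒L-single : ∀ {w} → L (pair y x) w → L (single x) w
    L-pair⇒L-single hw _ refl = hw x (inj₂ refl)

    ⇒-below : ∀ {w} → imgˡ _⊙_≔_ (y ⇒ x) y w → L (single x) w
    ⇒-below (v , (u , hu , ȳ⊕u) , v⊙y) =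
      L-pair⇒L-single (subst (L (pair y x)) (⊕-cancelˡ ȳ⊕u (to ⊙≔⇔bar-⊕ v⊙y)) hu)

    ⇒-attained : ∀ {w} → L (single x) w → imgˡ _⊙_≔_ (y ⇒ x) y w
    ⇒-attained {w} hw with ≤tilde⇒⊕-defined {bar y} (subst (w ≤_) (sym (tilde∘bar y)) (≤-trans (hw x refl) x≤y))
    ... | v , ȳ⊕w = v , (w , L-single⇒L-pair hw , ȳ⊕w) , from ⊙≔⇔bar-⊕ ȳ⊕w

    ⇝-below : ∀ {w} → imgʳ _⊙_≔_ y (y ⇝ x) w → L (single x) w
    ⇝-below (v , (u , hu , u⊕ỹ) , y⊙v) =
      L-pair⇒L-single (subst (L (pair y x)) (⊕-cancelʳ u⊕ỹ (to ⊙≔⇔⊕-tilde y⊙v)) hu)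

    ⇝-attained : ∀ {w} → L (single x) w → imgʳ _⊙_≔_ y (y ⇝ x) w
    ⇝-attained {w} hw with ≤tilde⇒⊕-defined {w} (tilde-antitone (≤-trans (hw x refl) x≤y))
    ... | v , w⊕ỹ = v , (w , L-single⇒L-pair hw , w⊕ỹ) , from ⊙≔⇔⊕-tilde w⊕ỹ

  L≤ˢU-mono : ∀ {A A′ B B′ : Subset Carrier} → A′ ⊆ A → B′ ⊆ B → L A′ ≤ˢ U B′ → L A ≤ˢ U B
  L≤ˢU-mono A′⊆A B′⊆B H a b ha hb = H a b (λ y → ha y ∘ A′⊆A) (λ y → hb y ∘ B′⊆B)

  module ConeDuality (f g : Carrier → Carrier)
    (f∘g : ∀ x → f (g x) ≡ x) (g∘f : ∀ x → g (f x) ≡ x)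
    (f-antitone : ∀ {x y} → x ≤ y → f y ≤ f x) (g-antitone : ∀ {x y} → x ≤ y → g y ≤ g x) where

    cone-duality : ∀ {A B : Subset Carrier} → L A ≤ˢ U B ⇔ L (B ∘ g) ≤ˢ U (A ∘ g)
    cone-duality {A} {B} = mk⇔ dual undual
      where
      dual : L A ≤ˢ U B → L (B ∘ g) ≤ˢ U (A ∘ g)
      dual H b′ a′ hb′ ha′ = subst₂ _≤_ (f∘g b′) (f∘g a′) (f-antitone (H (g a′) (g b′) ga′∈LA gb′∈UB))
        where
        ga′∈LA : L A (g a′)
        ga′∈LA a Aa = subst (g a′ ≤_) (g∘f a) (g-antitone (ha′ (f a) (subst A (sym (g∘f a)) Aa)))
        gb′∈UB : U B (g b′)
        gb′∈UB b Bb = subst (_≤ g b′) (g∘f b) (g-antitone (hb′ (f b) (subst B (sym (g∘f b)) Bb)))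

      undual : L (B ∘ g) ≤ˢ U (A ∘ g) → L A ≤ˢ U B
      undual H b a hb ha = subst₂ _≤_ (g∘f b) (g∘f a) (g-antitone (H (f a) (f b) fa∈L fb∈U))
        where
        fa∈L : L (B ∘ g) (f a)
        fa∈L p Bgp = subst (f a ≤_) (f∘g p) (f-antitone (ha (g p) Bgp))
        fb∈U : U (A ∘ g) (f b)
        fb∈U p Agp = subst (_≤ f b) (f∘g p) (f-antitone (hb (g p) Agp))

  open ConeDuality bar tilde bar∘tilde tilde∘bar bar-antitone tilde-antitone
    using () renaming (cone-duality to tilde-cone-duality)
  open ConeDuality tilde bar tilde∘bar bar∘tilde tilde-antitone bar-antitone
    using () renaming (cone-duality to bar-cone-duality)

  ⊕⇔tilde-⊙-bar : ∀ x y w → x ⊕ y ≡ just w ⇔ (∃ λ b → (tilde x ⊙ tilde y ≔ b) × (bar b ≡ w))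
  ⊕⇔tilde-⊙-bar x y w = mk⇔
    (λ e → tilde w , ⊙-intro (complements e) , bar∘tilde w)
    (λ { (b , h , refl) → subst₂ (λ s t → s ⊕ t ≡ just (bar b)) (bar∘tilde x) (bar∘tilde y) (⊙-elim h) })
    where
    complements : x ⊕ y ≡ just w → bar (tilde x) ⊕ bar (tilde y) ≡ just (bar (tilde w))
    complements e rewrite bar∘tilde x | bar∘tilde y | bar∘tilde w = e

  module _ (good : IsGood) where

    ⊙≔⇔tilde-⊕ : ∀ {x y z} → x ⊙ y ≔ z ⇔ tilde x ⊕ tilde y ≡ just (tilde z)
    ⊙≔⇔tilde-⊕ {x} {y} {z} = mk⇔
      (λ { (h , e) → map-injective bar-injective (trans (trans (sym (good x y h)) e) (cong just (sym (bar∘tilde z)))) })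
      (λ e → let x̃≤y = subst (tilde x ≤_) (bar∘tilde y) (⊕-defined⇒≤bar e) in
             x̃≤y , trans (good x y x̃≤y) (trans (cong (map bar) e) (cong just (bar∘tilde z))))

    tilde-⊙-bar⇔⊕ : ∀ x y w → (∃ λ a → (bar x ⊙ bar y ≔ a) × (tilde a ≡ w)) ⇔ x ⊕ y ≡ just w
    tilde-⊙-bar⇔⊕ x y w = mk⇔
      (λ { (a , h , refl) → subst₂ (λ s t → s ⊕ t ≡ just (tilde a)) (tilde∘bar x) (tilde∘bar y) (to ⊙≔⇔tilde-⊕ h) })
      (λ e → bar w , from ⊙≔⇔tilde-⊕ (complements e) , tilde∘bar w)
      where
      complements : x ⊕ y ≡ just w → tilde (bar x) ⊕ tilde (bar y) ≡ just (tilde (bar w))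
      complements e rewrite tilde∘bar x | tilde∘bar y | tilde∘bar w = e

    -- (R7): both sides say x + y = w.
    complement-⊙-complements : ∀ x y w →
      (∃ λ a → (bar x ⊙ bar y ≔ a) × (tilde a ≡ w)) ⇔ (∃ λ b → (tilde x ⊙ tilde y ≔ b) × (bar b ≡ w))
    complement-⊙-complements x y w = ⇔-trans (tilde-⊙-bar⇔⊕ x y w) (⊕⇔tilde-⊙-bar x y w)

  module _ (mono : IsMonotonous) where

    ⇒-adjoint : ∀ x y z →
      (L (imgˡ _⊙_≔_ (U (pair x (bar y))) y) ≤ˢ U (L (pair y z)))
      ⇔ (L (U (pair x (bar y))) ≤ˢ U (y ⇒ z))
    ⇒-adjoint x y z = mk⇔ adjoint-to adjoint-from
      where
      A A⊙y X Y : Subset Carrier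
      A = U (pair x (bar y))
      A⊙y = imgˡ _⊙_≔_ A y
      X = (y ⇒ z) ∘ tilde
      Y = A ∘ tilde

      ȳ⊕A⊙y⊆A : bar y ˢ+ A⊙y ⊆ A
      ȳ⊕A⊙y⊆A (v , (u , Au , u⊙y) , ȳ⊕v) = subst A (⊕-functional (to ⊙≔⇔bar-⊕ u⊙y) ȳ⊕v) Au

      below-y : ∀ a → A⊙y a ⊎ L (pair y z) a → a ≤ tilde (bar y)
      below-y a (inj₁ (_ , _ , a⊙y)) = ⊕-defined⇒≤tilde (to ⊙≔⇔bar-⊕ a⊙y)
      below-y a (inj₂ h) = subst (a ≤_) (sym (tilde∘bar y)) (h y (inj₁ refl))

      adjoint-to : L A⊙y ≤ˢ U (L (pair y z)) → L A ≤ˢ U (y ⇒ z)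
      adjoint-to H = L≤ˢU-mono ȳ⊕A⊙y⊆A (λ h → h)
        (proj₂ mono (bar y) A⊙y (L (pair y z)) (y , 𝟏 , 𝟏∈U , ⊙-identityˡ y) (𝟎 , 𝟎∈L) below-y H)

      below-ȳ : ∀ a → X a ⊎ Y a → a ≤ bar (bar y)
      below-ȳ a (inj₁ (w , _ , ȳ⊕w)) = ≤tilde⇒≤bar (w , ȳ⊕w)
      below-ȳ a (inj₂ Aã) = ≤tilde⇒≤bar (Aã (bar y) (inj₂ refl))

      X⊕ȳ⊆L∘tilde : X +ˢ bar y ⊆ L (pair y z) ∘ tilde
      X⊕ȳ⊆L∘tilde {p} (q , (w , hw , ȳ⊕w) , q⊕ȳ) = subst (L (pair y z)) w≡p̃ hw
        where
        w≡p̃ : w ≡ tilde p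
        w≡p̃ = trans (sym (tilde∘bar w)) (cong tilde (⊕-functional
                (subst (λ s → s ⊕ bar y ≡ just (bar w)) (bar∘tilde q) (⊕-bar ȳ⊕w)) q⊕ȳ))

      Y⊕ȳ⊆A⊙y∘tilde : Y +ˢ bar y ⊆ A⊙y ∘ tilde
      Y⊕ȳ⊆A⊙y∘tilde {p} (q , Aq̃ , q⊕ȳ) =
        tilde q , Aq̃ , ⊙-intro (subst₂ (λ s t → s ⊕ bar y ≡ just t) (sym (bar∘tilde q)) (sym (bar∘tilde p)) q⊕ȳ)

      adjoint-from : L A ≤ˢ U (y ⇒ z) → L A⊙y ≤ˢ U (L (pair y z))
      adjoint-from H = from tilde-cone-duality (L≤ˢU-mono X⊕ȳ⊆L∘tilde Y⊕ȳ⊆A⊙y∘tilde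
        (proj₁ mono (bar y) X Y
          (bar (bar y) , 𝟎 , 𝟎∈L , subst (λ t → bar y ⊕ 𝟎 ≡ just t) (sym (tilde∘bar (bar y))) (⊕-identityʳ (bar y)))
          (bar 𝟏 , subst A (sym (tilde∘bar 𝟏)) 𝟏∈U)
          below-ȳ (to tilde-cone-duality H)))

  module _ (good : IsGood) (mono : IsMonotonous) where

    ⇝-adjoint : ∀ x y z →
      (L (imgʳ _⊙_≔_ y (U (pair x (tilde y)))) ≤ˢ U (L (pair y z)))
      ⇔ (L (U (pair x (tilde y))) ≤ˢ U (y ⇝ z))
    ⇝-adjoint x y z = mk⇔ adjoint-to adjoint-from
      where
      A y⊙A X Y : Subset Carrier
      A = U (pair x (tilde y))
      y⊙A = imgʳ _⊙_≔_ y A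
      X = (y ⇝ z) ∘ bar
      Y = A ∘ bar

      y⊙A⊕ỹ⊆A : y⊙A +ˢ tilde y ⊆ A
      y⊙A⊕ỹ⊆A (v , (u , Au , y⊙u) , v⊕ỹ) = subst A (⊕-functional (to ⊙≔⇔⊕-tilde y⊙u) v⊕ỹ) Au

      below-y : ∀ a → y⊙A a ⊎ L (pair y z) a → a ≤ bar (tilde y)
      below-y a (inj₁ (_ , _ , y⊙a)) = ⊕-defined⇒≤bar (to ⊙≔⇔⊕-tilde y⊙a)
      below-y a (inj₂ h) = subst (a ≤_) (sym (bar∘tilde y)) (h y (inj₁ refl))

      adjoint-to : L y⊙A ≤ˢ U (L (pair y z)) → L A ≤ˢ U (y ⇝ z)
      adjoint-to H = L≤ˢU-mono y⊙A⊕ỹ⊆A (λ h → h)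
        (proj₁ mono (tilde y) y⊙A (L (pair y z)) (y , 𝟏 , 𝟏∈U , ⊙-identityʳ y) (𝟎 , 𝟎∈L) below-y H)

      below-ỹ : ∀ a → X a ⊎ Y a → a ≤ tilde (tilde y)
      below-ỹ a (inj₁ (w , _ , w⊕ỹ)) = ≤bar⇒≤tilde (⊕⇒≤ʳ w⊕ỹ)
      below-ỹ a (inj₂ Aā) = ≤bar⇒≤tilde (Aā (tilde y) (inj₂ refl))

      ỹ⊕X⊆L∘bar : tilde y ˢ+ X ⊆ L (pair y z) ∘ bar
      ỹ⊕X⊆L∘bar {p} (q , (w , hw , w⊕ỹ) , ỹ⊕q) = subst (L (pair y z)) w≡p̄ hw
        where
        w≡p̄ : w ≡ bar p
        w≡p̄ = trans (sym (bar∘tilde w)) (cong bar (⊕-functional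
                (subst (λ s → tilde y ⊕ s ≡ just (tilde w)) (tilde∘bar q) (⊕-tilde w⊕ỹ)) ỹ⊕q))

      -- The only use of goodness in the residuation laws.
      ỹ⊕Y⊆y⊙A∘bar : tilde y ˢ+ Y ⊆ y⊙A ∘ bar
      ỹ⊕Y⊆y⊙A∘bar {p} (q , Aq̄ , ỹ⊕q) =
        bar q , Aq̄ , from (⊙≔⇔tilde-⊕ good)
          (subst₂ (λ s t → tilde y ⊕ s ≡ just t) (sym (tilde∘bar q)) (sym (tilde∘bar p)) ỹ⊕q)

      adjoint-from : L A ≤ˢ U (y ⇝ z) → L y⊙A ≤ˢ U (L (pair y z))
      adjoint-from H = from bar-cone-duality (L≤ˢU-mono ỹ⊕X⊆L∘bar ỹ⊕Y⊆y⊙A∘bar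
        (proj₂ mono (tilde y) X Y
          (tilde (tilde y) , 𝟎 , 𝟎∈L , subst (λ t → 𝟎 ⊕ tilde y ≡ just t) (sym (bar∘tilde (tilde y))) (⊕-identityˡ (tilde y)))
          (tilde 𝟏 , subst A (sym (bar∘tilde 𝟏)) 𝟏∈U)
          below-ỹ (to bar-cone-duality H)))

    isUnsharpResiduatedPoset : IsUnsharpResiduatedPoset Carrier _≤_ _⊙_≔_ _⇒_ _⇝_ bar tilde 𝟎 𝟏
    isUnsharpResiduatedPoset = record
      { R1-partialOrder = ≤-isPartialOrder
      ; R1-bottom = 𝟎-least
      ; R1-top = 𝟏-greatest
      ; R2-tilde-bar = tilde∘bar
      ; R2-bar-tilde = bar∘tilde
      ; R2-bar-anti = λ _ _ → bar-antitone
      ; R2-tilde-anti = λ _ _ → tilde-antitone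
      ; R3-functional = λ _ _ _ _ → ⊙-functional
      ; R3-assoc = ⊙-assoc
      ; R3-unitʳ = ⊙-identityʳ
      ; R3-unitˡ = ⊙-identityˡ
      ; R3-domain = ⊙-domain
      ; R3-monoˡ = λ _ _ _ _ _ _ → ⊙-monoˡ-≤
      ; R3-monoʳ = λ _ _ _ _ _ _ → ⊙-monoʳ-≤
      ; R4 = ⇒-adjoint mono
      ; R5 = ⇝-adjoint
      ; R6-⇒ = ⇒-𝟎
      ; R6-⇝ = ⇝-𝟎
      ; R7 = complement-⊙-complements good
      }

theorem4 : (𝐏 : PseudoEffectAlgebra) →
    PEA.IsGood 𝐏 → PEA.IsMonotonous 𝐏 →
    IsUnsharpResiduatedPoset (PEA.Carrier 𝐏) (PEA._≤_ 𝐏) (PEA._⊙_≔_ 𝐏)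
      (PEA._⇒_ 𝐏) (PEA._⇝_ 𝐏) (PEA.bar 𝐏) (PEA.tilde 𝐏) (PEA.𝟎 𝐏) (PEA.𝟏 𝐏)
    × IsDivisible (PEA.Carrier 𝐏) (PEA._≤_ 𝐏) (PEA._⊙_≔_ 𝐏) (PEA._⇒_ 𝐏) (PEA._⇝_ 𝐏)
theorem4 𝐏 good mono = isUnsharpResiduatedPoset good mono , isDivisible
  where open PseudoEffectAlgebraProperties 𝐏
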